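{- Let $S,S',S''$ be $\mathfrak S$-types and $M:S\to(S'\to S'')$ a model. If $M$ is continuous, then $M$ is weakly continuous.
   Context: $\mathfrak S$-types are defined inductively: every finite non-empty type is an $\mathfrak S$-type; if $S,S'$ are $\mathfrak S$-types then so is $S\times S'$; if $S$ is an $\mathfrak S$-type then so is $\mathbb N\to S$. The exactness type $E(S)$: $E(F)=\mathbf 1$ for finite $F$; $E(S\times S')=E(S)\times E(S')$; $E(\mathbb N\to S)=\mathbb N\times E(S)$. Equality with precision $p\in E(S)$, $x\equiv_p y$: for finite types iff $x=y$; for products componentwise; for sequences, $\alpha\equiv_{(m,p)}\beta$ iff $\alpha(i)\equiv_p\beta(i)$ for all $i<m$. A function $f:T\to T'$ between $\mathfrak S$-types is continuous if for every $p\in E(T')$ there is $q\in E(T)$ with $x\equiv_q x'\Rightarrow f(x)\equiv_p f(x')$. A model $M:S\to(S'\to S'')$ (write $M_k=M(k)$) is called continuous if its uncurried form $S\times S'\to S''$, $(k,x)\mapsto M_k(x)$, is continuous. For $f,g:S'\to S''$ and $p\in E(S'')$, $f\approx_p g$ means $f(x)\equiv_p g(x)$ for all $x\in S'$. $M$ is weakly continuous if for every $p\in E(S'')$ there is $q\in E(S)$ such that for all $k,k'\in S$, $k\equiv_q k'$ implies $M_k\approx_p M_{k'}$. -}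

module Defs where

open import Data.Nat using (ℕ; suc; _<_)
open import Data.Fin using (Fin)
open import Data.Unit using (⊤)
open import Data.Product using (_×_; _,_; Σ; proj₁; proj₂)
open import Relation.Binary.PropositionalEquality using (_≡_)

-- Codes for 𝔖-types.  A finite non-empty type is represented by Fin (suc n).
data 𝔖 : Set where
  fin : ℕ → 𝔖
  _⊗_ : 𝔖 → 𝔖 → 𝔖
  seq : 𝔖 → 𝔖

infixr 5 _⊗_

El : 𝔖 → Set
El (fin n) = Fin (suc n)
El (S ⊗ T) = El S × El T
El (seq S) = ℕ → El S

E : 𝔖 → Set
E (fin n) = ⊤
E (S ⊗ T) = E S × E T
E (seq S) = ℕ × E S

Eq : (S : 𝔖) → E S → El S → El S → Set
Eq (fin n) p x y = x ≡ y
Eq (S ⊗ T) (p , q) (x , x') (y , y') = Eq S p x y × Eq T q x' y'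
Eq (seq S) (m , p) α β = (i : ℕ) → i < m → Eq S p (α i) (β i)

syntax Eq S p x y = x ≡[ S , p ] y

Continuous : (T T' : 𝔖) → (El T → El T') → Set
Continuous T T' f =
  (p : E T') → Σ (E T) λ q → (x x' : El T) → Eq T q x x' → Eq T' p (f x) (f x')

Model : (S S' S'' : 𝔖) → Set
Model S S' S'' = El S → El S' → El S''

Approx : (S' S'' : 𝔖) → E S'' → (El S' → El S'') → (El S' → El S'') → Set
Approx S' S'' p f g = (x : El S') → Eq S'' p (f x) (g x)

ContinuousModel : (S S' S'' : 𝔖) → Model S S' S'' → Set
ContinuousModel S S' S'' M =
  Continuous (S ⊗ S') S'' (λ kx → M (proj₁ kx) (proj₂ kx))

WeaklyContinuous : (S S' S'' : 𝔖) → Model S S' S'' → Set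
WeaklyContinuous S S' S'' M =
  (p : E S'') → Σ (E S) λ q →
    (k k' : El S) → Eq S q k k' → Approx S' S'' p (M k) (M k')

module Submission where

open import Defs
open import Data.Product using (_,_)
open import Relation.Binary.PropositionalEquality using (refl)

Eq-refl : (S : 𝔖) (p : E S) (x : El S) → Eq S p x x
Eq-refl (fin n) p x = refl
Eq-refl (S ⊗ T) (p , q) (x , y) = Eq-refl S p x , Eq-refl T q y
Eq-refl (seq S) (m , p) α i _ = Eq-refl S p (α i)

mainTheorem9 : (S S' S'' : 𝔖) (M : Model S S' S'') →
    ContinuousModel S S' S'' M → WeaklyContinuous S S' S'' M
mainTheorem9 S S' S'' M continuous p =
  let ((q , q') , modulus) = continuous p
  in q , λ k k' k≡k' x → modulus (k , x) (k' , x) (k≡k' , Eq-refl S' q' x)
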